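{- Let $d\ge2$ and let $(A_{m,n})$ be the $d$-Ostrowski array and $(\bar A_{k,n})$ the negative $d$-Ostrowski array. For every $m\ge1$ there exist $k\ge1$ and $i\in\{0,1\}$ such that $A_{m,n}=|\bar A_{k,i+n}|$ for all $n\ge1$.
   Context: Define $(D_n)$ by $D_0=0$, $D_1=1$, $D_{n+1}=dD_n+D_{n-1}$. An Ostrowski word is a finite word $d_1\cdots d_i$ over $\{0,\dots,d\}$ with $0\le d_1<d$, $0\le d_j\le d$ for $j>1$, and $d_{j-1}=0$ whenever $d_j=d$; it represents $\sum_j d_jD_j$. Every non-negative integer has a unique Ostrowski word with nonzero last digit. An Ostrowski word is trimmed if its last digit is nonzero and it cannot be written as $0v$ with $v$ an Ostrowski word (equivalently, its first digit is nonzero, or its first two digits are $0$ and $d$). Let $w_1,w_2,\dots$ be the trimmed Ostrowski words listed in increasing order of the integers they represent, and $|w_m|$ the length of $w_m$. The $d$-Ostrowski array is $A_{m,n}=$ the integer represented by $0^{n-1}w_m$ ($m,n\ge1$); its rows satisfy $A_{m,n+1}=dA_{m,n}+A_{m,n-1}$ and are extended to all $n\in\mathbb Z$ by this recurrence. The negative $d$-Ostrowski array is $\bar A_{k,n}=A_{k,r_k-n}$ for $k\ge1$, $n\ge1$, where $r_k=1-|w_k|$. -}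

module Defs where

open import Data.Nat using (ℕ; zero; suc; _+_; _*_; _∸_; _≤_; _<_; NonZero)
open import Data.Integer as ℤ using (ℤ; +_; -[1+_]; ∣_∣)
open import Data.List using (List; []; _∷_; _++_; replicate; length)
open import Data.List.Relation.Unary.All using (All)
open import Data.Product using (Σ; _×_; _,_; proj₁; proj₂)
open import Data.Unit using (⊤)
open import Data.Empty using (⊥)
open import Relation.Nullary using (¬_)
open import Relation.Binary.PropositionalEquality using (_≡_; _≢_)

D : ℕ → ℕ → ℕ
D d zero = 0
D d (suc zero) = 1
D d (suc (suc n)) = d * D d (suc n) + D d n

-- Words are lists of digits; the head of the list is the digit d_1.
-- Value of d_j d_{j+1} ... placed starting at position j.
valFrom : ℕ → ℕ → List ℕ → ℕ
valFrom d j [] = 0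
valFrom d j (x ∷ xs) = x * D d j + valFrom d (suc j) xs

val : ℕ → List ℕ → ℕ
val d w = valFrom d 1 w

FirstOK : ℕ → List ℕ → Set
FirstOK d [] = ⊤
FirstOK d (x ∷ _) = x < d

AdjOK : ℕ → List ℕ → Set
AdjOK d [] = ⊤
AdjOK d (x ∷ []) = ⊤
AdjOK d (x ∷ y ∷ r) = (y ≡ d → x ≡ 0) × AdjOK d (y ∷ r)

IsOstrowski : ℕ → List ℕ → Set
IsOstrowski d w = FirstOK d w × All (_≤ d) w × AdjOK d w

LastNonzero : List ℕ → Set
LastNonzero [] = ⊥
LastNonzero (x ∷ []) = x ≢ 0
LastNonzero (x ∷ y ∷ r) = LastNonzero (y ∷ r)

Trimmed : ℕ → List ℕ → Set
Trimmed d w = IsOstrowski d w × LastNonzero w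
            × ¬ (Σ (List ℕ) λ v → (w ≡ 0 ∷ v) × IsOstrowski d v)

-- e enumerates the trimmed words w_1, w_2, ... (as e 1, e 2, ...; e 0 unused)
-- in increasing order of the integers they represent.
IsTrimmedEnumeration : ℕ → (ℕ → List ℕ) → Set
IsTrimmedEnumeration d e =
  (∀ m → 1 ≤ m → Trimmed d (e m))
  × (∀ m → 1 ≤ m → val d (e m) < val d (e (suc m)))
  × (∀ w → Trimmed d w → Σ ℕ λ m → 1 ≤ m × e m ≡ w)

-- Backward recurrence: from (x_1, x_2) compute (x_{1-j}, x_{2-j}),
-- using x_{n-1} = x_{n+1} - d x_n.
back : ℕ → ℕ → ℤ → ℤ → ℤ × ℤ
back d zero a b = a , b
back d (suc j) a b =
  let p = back d j a b in (proj₂ p ℤ.- (+ d) ℤ.* proj₁ p) , proj₁ p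

-- Extension to all of ℤ of a row given for n ≥ 1 by f n, via the recurrence.
Row : ℕ → (ℕ → ℕ) → ℤ → ℤ
Row d f (+ suc n) = + f (suc n)
Row d f (+ zero) = proj₁ (back d 1 (+ f 1) (+ f 2))
Row d f -[1+ n ] = proj₁ (back d (suc (suc n)) (+ f 1) (+ f 2))

-- d-Ostrowski array: A_{m,n} = integer represented by 0^{n-1} w_m (n ≥ 1),
-- extended to n ∈ ℤ by A_{m,n+1} = d A_{m,n} + A_{m,n-1}.
A : ℕ → (ℕ → List ℕ) → ℕ → ℤ → ℤ
A d e m = Row d (λ n → val d (replicate (n ∸ 1) 0 ++ e m))

r : (ℕ → List ℕ) → ℕ → ℤ
r e k = + 1 ℤ.- + length (e k)

Abar : ℕ → (ℕ → List ℕ) → ℕ → ℤ → ℤ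
Abar d e k n = A d e k (r e k ℤ.- n)

-- Rows are solutions of X (n + 1) = d X n + X (n - 1), handled through their
-- states (X t , X (t + 1)), on which the recurrence runs backwards linearly.
-- The state of the row of a word y at index 1 - |y| is the state at 0 of the
-- row of y read backwards, while the row of x at -1, -2, … is, up to sign, the
-- row of the alternating string x₁, -x₂, x₃, … . So it suffices to rewrite
-- that alternating string into a trimmed word read backwards, which is done
-- pair by pair with the borrow D n = d D (n - 1) + D (n - 2). A leading 0 of x,
-- or a final 0 produced by the rewriting, costs one more backward step: the
-- shift i = 1.

{-# OPTIONS --safe #-}
module Submission where

open import Defs
open import Data.Nat as ℕ using (ℕ; zero; suc; _+_; _∸_; _≤_; _<_; z≤n; s≤s)
import Data.Nat.Properties as ℕ
open import Data.Integer as ℤ using (ℤ; +_; ∣_∣; 0ℤ; 1ℤ; -1ℤ)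
import Data.Integer.Properties as ℤ
open import Data.Integer.Tactic.RingSolver using (solve-∀)
open import Data.Nat.Tactic.RingSolver renaming (solve-∀ to ℕ-solve-∀)
open import Data.List using (List; []; _∷_; _++_; map; reverse; _ʳ++_; replicate; length)
open import Data.Product using (Σ; _×_; _,_; proj₁; proj₂)
open import Relation.Binary.PropositionalEquality
open import Function using (_∘_)
open import Data.Bool using (Bool; true; false; T)
open import Data.Unit using (tt)
open import Data.Empty using (⊥-elim)
open import Relation.Nullary using (yes; no; ¬_)
open import Relation.Nullary.Decidable using (T?)
open import Data.List.Relation.Unary.All as All using (All; []; _∷_)
import Data.List.Properties as List

pos-*+ : ∀ a b c → + (a ℕ.* b + c) ≡ + a ℤ.* + b ℤ.+ + c
pos-*+ a b c = trans (ℤ.pos-+ (a ℕ.* b) c) (cong (ℤ._+ + c) (ℤ.pos-* a b))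

pos-∸ : ∀ {m n} → n ≤ m → + (m ∸ n) ≡ + m ℤ.- + n
pos-∸ {m} {n} n≤m = sym (trans (ℤ.m-n≡m⊖n m n) (ℤ.⊖-≥ n≤m))

m∸1<n : ∀ {m n} → 1 ≤ m → m ≤ n → m ∸ 1 < n
m∸1<n (s≤s _) m≤n = m≤n

m∸n≡m⇒n≡0 : ∀ {m} n → 1 ≤ m → m ∸ n ≡ m → n ≡ 0
m∸n≡m⇒n≡0         zero    _ _ = refl
m∸n≡m⇒n≡0 {suc m} (suc n) _ e = ⊥-elim (ℕ.<-irrefl e (s≤s (ℕ.m∸n≤m m n)))

m+0≢0 : ∀ {m} → 1 ≤ m → m + 0 ≢ 0
m+0≢0 {m} 1≤m = ℕ.m<n⇒n≢0 1≤m ∘ ℕ.m+n≡0⇒m≡0 m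

sign : ℕ → ℤ
sign zero    = 1ℤ
sign (suc k) = ℤ.- sign k

∣sign*∣ : ∀ k z → ∣ sign k ℤ.* z ∣ ≡ ∣ z ∣
∣sign*∣ k z = trans (ℤ.abs-* (sign k) z) (trans (cong (ℕ._* ∣ z ∣) (∣sign∣ k)) (ℕ.*-identityˡ ∣ z ∣))
  where
  ∣sign∣ : ∀ k → ∣ sign k ∣ ≡ 1
  ∣sign∣ zero    = refl
  ∣sign∣ (suc k) = trans (ℤ.∣-i∣≡∣i∣ (sign k)) (∣sign∣ k)

map-neg-involutive : ∀ t → map ℤ.-_ (map ℤ.-_ t) ≡ t
map-neg-involutive t = trans (sym (List.map-∘ t)) (trans (List.map-cong ℤ.neg-involutive t) (List.map-id t))

head₀ : List ℕ → ℕ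
head₀ []      = 0
head₀ (a ∷ _) = a

lastNonzero-∷ : ∀ a w → LastNonzero w → LastNonzero (a ∷ w)
lastNonzero-∷ a (_ ∷ _) ln = ln

module _ (d : ℕ) where

  -- A state (x , y) stands for two consecutive terms (X t , X (t + 1)) of a
  -- solution of X (t + 1) = d X t + X (t - 1); step moves it to t - 1.
  State : Set
  State = ℤ × ℤ

  step : State → State
  step p = proj₂ p ℤ.- + d ℤ.* proj₁ p , proj₁ p

  steps : ℕ → State → State
  steps zero    p = p
  steps (suc j) p = step (steps j p)

  back≡steps : ∀ j a b → back d j a b ≡ steps j (a , b)
  back≡steps zero    a b = refl
  back≡steps (suc j) a b = cong step (back≡steps j a b)

  steps-suc : ∀ j p → steps (suc j) p ≡ steps j (step p)
  steps-suc zero    p = refl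
  steps-suc (suc j) p = cong step (steps-suc j p)

  steps-+ : ∀ i j p → steps (i + j) p ≡ steps i (steps j p)
  steps-+ zero    j p = refl
  steps-+ (suc i) j p = cong step (steps-+ i j p)

  infixl 6 _⊕_
  infixr 7 _⊙_

  _⊕_ : State → State → State
  p ⊕ q = proj₁ p ℤ.+ proj₁ q , proj₂ p ℤ.+ proj₂ q

  _⊙_ : ℤ → State → State
  k ⊙ p = k ℤ.* proj₁ p , k ℤ.* proj₂ p

  0ₛ : State
  0ₛ = 0ℤ , 0ℤ

  ⊕-comm : ∀ p q → p ⊕ q ≡ q ⊕ p
  ⊕-comm p q = cong₂ _,_ (ℤ.+-comm (proj₁ p) (proj₁ q)) (ℤ.+-comm (proj₂ p) (proj₂ q))

  ⊕-assoc : ∀ p q r → p ⊕ q ⊕ r ≡ p ⊕ (q ⊕ r)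
  ⊕-assoc p q r = cong₂ _,_ (ℤ.+-assoc (proj₁ p) _ _) (ℤ.+-assoc (proj₂ p) _ _)

  ⊕-identityˡ : ∀ p → 0ₛ ⊕ p ≡ p
  ⊕-identityˡ p = cong₂ _,_ (ℤ.+-identityˡ (proj₁ p)) (ℤ.+-identityˡ (proj₂ p))

  ⊕-identityʳ : ∀ p → p ⊕ 0ₛ ≡ p
  ⊕-identityʳ p = cong₂ _,_ (ℤ.+-identityʳ (proj₁ p)) (ℤ.+-identityʳ (proj₂ p))

  ⊙-identityˡ : ∀ p → 1ℤ ⊙ p ≡ p
  ⊙-identityˡ p = cong₂ _,_ (ℤ.*-identityˡ (proj₁ p)) (ℤ.*-identityˡ (proj₂ p))

  ⊙-assoc : ∀ k l p → k ⊙ l ⊙ p ≡ (k ℤ.* l) ⊙ p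
  ⊙-assoc k l p = cong₂ _,_ (sym (ℤ.*-assoc k l (proj₁ p))) (sym (ℤ.*-assoc k l (proj₂ p)))

  step-⊕ : ∀ p q → step (p ⊕ q) ≡ step p ⊕ step q
  step-⊕ (x , y) (x′ , y′) = cong₂ _,_ (lemma x y x′ y′ (+ d)) refl
    where
    lemma : ∀ x y x′ y′ D → (y ℤ.+ y′) ℤ.- D ℤ.* (x ℤ.+ x′) ≡ (y ℤ.- D ℤ.* x) ℤ.+ (y′ ℤ.- D ℤ.* x′)
    lemma = solve-∀

  step-⊙ : ∀ k p → step (k ⊙ p) ≡ k ⊙ step p
  step-⊙ k (x , y) = cong₂ _,_ (lemma k x y (+ d)) refl
    where
    lemma : ∀ k x y D → k ℤ.* y ℤ.- D ℤ.* (k ℤ.* x) ≡ k ℤ.* (y ℤ.- D ℤ.* x)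
    lemma = solve-∀

  steps-⊕ : ∀ j p q → steps j (p ⊕ q) ≡ steps j p ⊕ steps j q
  steps-⊕ zero    p q = refl
  steps-⊕ (suc j) p q = trans (cong step (steps-⊕ j p q)) (step-⊕ (steps j p) (steps j q))

  steps-⊙ : ∀ j k p → steps j (k ⊙ p) ≡ k ⊙ steps j p
  steps-⊙ zero    k p = refl
  steps-⊙ (suc j) k p = trans (cong step (steps-⊙ j k p)) (step-⊙ k (steps j p))

  -- 0ℤ ⊙ p computes to 0ₛ for every p.
  steps-0ₛ : ∀ j → steps j 0ₛ ≡ 0ₛ
  steps-0ₛ j = steps-⊙ j 0ℤ 0ₛ

  rowD : ℕ → State
  rowD k = + D d k , + D d (suc k)

  pos-D : ∀ k → + D d (suc (suc k)) ≡ + d ℤ.* + D d (suc k) ℤ.+ + D d k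
  pos-D k = trans (ℤ.pos-+ (d ℕ.* D d (suc k)) (D d k)) (cong (ℤ._+ + D d k) (ℤ.pos-* d (D d (suc k))))

  step-rowD : ∀ k → step (rowD (suc k)) ≡ rowD k
  step-rowD k = cong₂ _,_ (trans (cong (ℤ._- + d ℤ.* + D d (suc k)) (pos-D k)) (lemma (+ D d (suc k)) (+ D d k) (+ d))) refl
    where
    lemma : ∀ a b D → (D ℤ.* a ℤ.+ b) ℤ.- D ℤ.* a ≡ b
    lemma = solve-∀

  steps-rowD : ∀ k → steps k (rowD k) ≡ rowD 0
  steps-rowD zero    = refl
  steps-rowD (suc k) = trans (steps-suc k (rowD (suc k))) (trans (cong (steps k) (step-rowD k)) (steps-rowD k))

  rowD-negative : ∀ k → steps (suc k) (rowD 0) ≡ (sign k ℤ.* + D d (suc k) , sign (suc k) ℤ.* + D d k)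
  rowD-negative zero    = cong₂ _,_ (lemma (+ d)) refl
    where
    lemma : ∀ D → 1ℤ ℤ.- D ℤ.* 0ℤ ≡ 1ℤ ℤ.* 1ℤ
    lemma = solve-∀
  rowD-negative (suc k) =
    trans (cong step (rowD-negative k)) (cong₂ _,_ first (cong (ℤ._* + D d (suc k)) (sym (ℤ.neg-involutive (sign k)))))
    where
    lemma : ∀ s a b D → (ℤ.- s) ℤ.* b ℤ.- D ℤ.* (s ℤ.* a) ≡ (ℤ.- s) ℤ.* (D ℤ.* a ℤ.+ b)
    lemma = solve-∀
    first : (ℤ.- sign k) ℤ.* + D d k ℤ.- + d ℤ.* (sign k ℤ.* + D d (suc k)) ≡ sign (suc k) ℤ.* + D d (suc (suc k))
    first = trans (lemma (sign k) (+ D d (suc k)) (+ D d k) (+ d)) (cong (sign (suc k) ℤ.*_) (sym (pos-D k)))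

  -- Signed digit strings

  push : ℤ → State → State
  push a p = proj₂ p ℤ.- + d ℤ.* proj₁ p , proj₁ p ℤ.+ a

  push-linear : ∀ a p → push a p ≡ a ⊙ rowD 0 ⊕ step p
  push-linear a (x , y) = cong₂ _,_ (lemma₀ a (y ℤ.- + d ℤ.* x)) (lemma₁ a x)
    where
    lemma₀ : ∀ a z → z ≡ a ℤ.* 0ℤ ℤ.+ z
    lemma₀ = solve-∀
    lemma₁ : ∀ a x → x ℤ.+ a ≡ a ℤ.* 1ℤ ℤ.+ x
    lemma₁ = solve-∀

  push-0ℤ : ∀ p → push 0ℤ p ≡ step p
  push-0ℤ p = cong₂ _,_ refl (ℤ.+-identityʳ (proj₁ p))

  steps-push : ∀ j a p → steps j (push a p) ≡ a ⊙ steps j (rowD 0) ⊕ steps (suc j) p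
  steps-push j a p = begin
    steps j (push a p)                          ≡⟨ cong (steps j) (push-linear a p) ⟩
    steps j (a ⊙ rowD 0 ⊕ step p)               ≡⟨ steps-⊕ j _ _ ⟩
    steps j (a ⊙ rowD 0) ⊕ steps j (step p)     ≡⟨ cong₂ _⊕_ (steps-⊙ j a (rowD 0)) (sym (steps-suc j p)) ⟩
    a ⊙ steps j (rowD 0) ⊕ steps (suc j) p      ∎
    where open ≡-Reasoning

  -- ⟦ t ⟧ is the state at index 0 of the solution n ↦ Σᵣ tᵣ D (n + 1 - r).
  ⟦_⟧ : List ℤ → State
  ⟦ [] ⟧    = 0ₛ
  ⟦ a ∷ t ⟧ = push a ⟦ t ⟧

  ⟦⟧-ʳ++-cong : ∀ s {t u} → ⟦ t ⟧ ≡ ⟦ u ⟧ → ⟦ s ʳ++ t ⟧ ≡ ⟦ s ʳ++ u ⟧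
  ⟦⟧-ʳ++-cong []      eq = eq
  ⟦⟧-ʳ++-cong (a ∷ s) eq = ⟦⟧-ʳ++-cong s (cong (push a) eq)

  ⟦⟧-neg : ∀ t → ⟦ map ℤ.-_ t ⟧ ≡ -1ℤ ⊙ ⟦ t ⟧
  ⟦⟧-neg []      = refl
  ⟦⟧-neg (a ∷ t) = trans (cong (push (ℤ.- a)) (⟦⟧-neg t)) (cong₂ _,_ (lemma₀ x y (+ d)) (lemma₁ a x))
    where
    x = proj₁ ⟦ t ⟧
    y = proj₂ ⟦ t ⟧
    lemma₀ : ∀ x y D → -1ℤ ℤ.* y ℤ.- D ℤ.* (-1ℤ ℤ.* x) ≡ -1ℤ ℤ.* (y ℤ.- D ℤ.* x)
    lemma₀ = solve-∀
    lemma₁ : ∀ a x → -1ℤ ℤ.* x ℤ.+ ℤ.- a ≡ -1ℤ ℤ.* (x ℤ.+ a)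
    lemma₁ = solve-∀

  carryIn : ℤ → List ℤ → List ℤ
  carryIn c []      = c ∷ []
  carryIn c (a ∷ t) = a ℤ.+ c ∷ t

  ⟦carryIn⟧ : ∀ c t → ⟦ carryIn c t ⟧ ≡ ⟦ t ⟧ ⊕ (0ℤ , c)
  ⟦carryIn⟧ c []      = cong₂ _,_ (lemma (+ d)) refl
    where
    lemma : ∀ D → 0ℤ ℤ.- D ℤ.* 0ℤ ≡ 0ℤ ℤ.+ 0ℤ
    lemma = solve-∀
  ⟦carryIn⟧ c (a ∷ t) = cong₂ _,_ (sym (ℤ.+-identityʳ _)) (sym (ℤ.+-assoc (proj₁ ⟦ t ⟧) a c))

  ⟦carryIn-0ℤ⟧ : ∀ t → ⟦ carryIn 0ℤ t ⟧ ≡ ⟦ t ⟧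
  ⟦carryIn-0ℤ⟧ t = trans (⟦carryIn⟧ 0ℤ t) (⊕-identityʳ ⟦ t ⟧)

  -- One unit in position 1 is worth d units in position 2 plus one in
  -- position 3, because D n = d D (n - 1) + D (n - 2).
  ⟦⟧-borrow : ∀ a b t → ⟦ a ∷ b ∷ t ⟧ ≡ ⟦ a ℤ.- 1ℤ ∷ b ℤ.+ + d ∷ carryIn 1ℤ t ⟧
  ⟦⟧-borrow a b t = begin
    push a (push b ⟦ t ⟧)                                      ≡⟨ cong₂ _,_ (lemma₀ a b x y (+ d)) (lemma₁ a x y (+ d)) ⟩
    push (a ℤ.- 1ℤ) (push (b ℤ.+ + d) (⟦ t ⟧ ⊕ (0ℤ , 1ℤ)))     ≡⟨ cong (push _ ∘ push _) (sym (⟦carryIn⟧ 1ℤ t)) ⟩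
    push (a ℤ.- 1ℤ) (push (b ℤ.+ + d) ⟦ carryIn 1ℤ t ⟧)        ∎
    where
    open ≡-Reasoning
    x = proj₁ ⟦ t ⟧
    y = proj₂ ⟦ t ⟧
    lemma₀ : ∀ a b x y D → (x ℤ.+ b) ℤ.- D ℤ.* (y ℤ.- D ℤ.* x)
                         ≡ ((x ℤ.+ 0ℤ) ℤ.+ (b ℤ.+ D)) ℤ.- D ℤ.* ((y ℤ.+ 1ℤ) ℤ.- D ℤ.* (x ℤ.+ 0ℤ))
    lemma₀ = solve-∀
    lemma₁ : ∀ a x y D → (y ℤ.- D ℤ.* x) ℤ.+ a ≡ ((y ℤ.+ 1ℤ) ℤ.- D ℤ.* (x ℤ.+ 0ℤ)) ℤ.+ (a ℤ.- 1ℤ)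
    lemma₁ = solve-∀

  -- Rows of words at negative indices

  valState : ℕ → List ℕ → State
  valState j w = + valFrom d (suc j) w , + valFrom d (suc (suc j)) w

  valState-∷ : ∀ j a w → valState j (a ∷ w) ≡ + a ⊙ rowD (suc j) ⊕ valState (suc j) w
  valState-∷ j a w = cong₂ _,_ (pos-*+ a _ _) (pos-*+ a _ _)

  steps-valState-ʳ++ : ∀ j w t →
    steps (j + length w) (valState j w) ⊕ steps (length w) ⟦ t ⟧ ≡ ⟦ map +_ w ʳ++ t ⟧
  steps-valState-ʳ++ j []      t = trans (cong (_⊕ ⟦ t ⟧) (steps-0ₛ (j + 0))) (⊕-identityˡ ⟦ t ⟧)
  steps-valState-ʳ++ j (a ∷ w) t = begin
    steps (j + suc L) (valState j (a ∷ w)) ⊕ steps (suc L) ⟦ t ⟧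
      ≡⟨ cong₂ (λ n v → steps n v ⊕ steps (suc L) ⟦ t ⟧) (ℕ.+-suc j L) (valState-∷ j a w) ⟩
    steps (suc j + L) (+ a ⊙ rowD (suc j) ⊕ V) ⊕ steps (suc L) ⟦ t ⟧
      ≡⟨ cong (_⊕ steps (suc L) ⟦ t ⟧) (steps-⊕ (suc j + L) _ V) ⟩
    steps (suc j + L) (+ a ⊙ rowD (suc j)) ⊕ steps (suc j + L) V ⊕ steps (suc L) ⟦ t ⟧
      ≡⟨ cong (_⊕ steps (suc L) ⟦ t ⟧) (⊕-comm _ (steps (suc j + L) V)) ⟩
    steps (suc j + L) V ⊕ steps (suc j + L) (+ a ⊙ rowD (suc j)) ⊕ steps (suc L) ⟦ t ⟧
      ≡⟨ ⊕-assoc (steps (suc j + L) V) _ _ ⟩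
    steps (suc j + L) V ⊕ (steps (suc j + L) (+ a ⊙ rowD (suc j)) ⊕ steps (suc L) ⟦ t ⟧)
      ≡⟨ cong (λ u → steps (suc j + L) V ⊕ (u ⊕ steps (suc L) ⟦ t ⟧)) digit ⟩
    steps (suc j + L) V ⊕ (+ a ⊙ steps L (rowD 0) ⊕ steps (suc L) ⟦ t ⟧)
      ≡⟨ cong (steps (suc j + L) V ⊕_) (sym (steps-push L (+ a) ⟦ t ⟧)) ⟩
    steps (suc j + L) V ⊕ steps L ⟦ + a ∷ t ⟧
      ≡⟨ steps-valState-ʳ++ (suc j) w (+ a ∷ t) ⟩
    ⟦ map +_ w ʳ++ + a ∷ t ⟧ ∎
    where
    open ≡-Reasoning
    L = length w
    V = valState (suc j) w
    digit : steps (suc j + L) (+ a ⊙ rowD (suc j)) ≡ + a ⊙ steps L (rowD 0)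
    digit = begin
      steps (suc j + L) (+ a ⊙ rowD (suc j))   ≡⟨ steps-⊙ (suc j + L) (+ a) (rowD (suc j)) ⟩
      + a ⊙ steps (suc j + L) (rowD (suc j))   ≡⟨ cong (λ n → + a ⊙ steps n (rowD (suc j))) (ℕ.+-comm (suc j) L) ⟩
      + a ⊙ steps (L + suc j) (rowD (suc j))   ≡⟨ cong (+ a ⊙_) (steps-+ L (suc j) (rowD (suc j))) ⟩
      + a ⊙ steps L (steps (suc j) (rowD (suc j)))   ≡⟨ cong (λ p → + a ⊙ steps L p) (steps-rowD (suc j)) ⟩
      + a ⊙ steps L (rowD 0)   ∎

  steps-valState-reverse : ∀ w → steps (length w) (valState 0 w) ≡ ⟦ reverse (map +_ w) ⟧
  steps-valState-reverse w = begin
    steps (length w) (valState 0 w)                              ≡⟨ sym (⊕-identityʳ _) ⟩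
    steps (length w) (valState 0 w) ⊕ 0ₛ                         ≡⟨ cong (steps (length w) (valState 0 w) ⊕_) (sym (steps-0ₛ (length w))) ⟩
    steps (length w) (valState 0 w) ⊕ steps (length w) ⟦ [] ⟧    ≡⟨ steps-valState-ʳ++ 0 w [] ⟩
    ⟦ reverse (map +_ w) ⟧                                       ∎
    where open ≡-Reasoning

  alternate : List ℕ → List ℤ
  alternate []      = []
  alternate (a ∷ s) = + a ∷ map ℤ.-_ (alternate s)

  steps-alternate : ∀ x n → proj₁ (steps (suc n) ⟦ alternate x ⟧) ≡ sign n ℤ.* + valFrom d (suc n) x
  steps-alternate []      n = trans (cong proj₁ (steps-0ₛ (suc n))) (sym (ℤ.*-zeroʳ (sign n)))
  steps-alternate (a ∷ s) n = begin
    proj₁ (steps (suc n) (push (+ a) ⟦ map ℤ.-_ (alternate s) ⟧))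
      ≡⟨ cong proj₁ (steps-push (suc n) (+ a) _) ⟩
    proj₁ (+ a ⊙ steps (suc n) (rowD 0) ⊕ steps (suc (suc n)) ⟦ map ℤ.-_ (alternate s) ⟧)
      ≡⟨ cong (λ p → proj₁ (+ a ⊙ steps (suc n) (rowD 0) ⊕ steps (suc (suc n)) p)) (⟦⟧-neg (alternate s)) ⟩
    proj₁ (+ a ⊙ steps (suc n) (rowD 0) ⊕ steps (suc (suc n)) (-1ℤ ⊙ ⟦ alternate s ⟧))
      ≡⟨ cong (λ p → proj₁ (+ a ⊙ steps (suc n) (rowD 0) ⊕ p)) (steps-⊙ (suc (suc n)) -1ℤ _) ⟩
    + a ℤ.* proj₁ (steps (suc n) (rowD 0)) ℤ.+ -1ℤ ℤ.* proj₁ (steps (suc (suc n)) ⟦ alternate s ⟧)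
      ≡⟨ cong₂ (λ u v → + a ℤ.* u ℤ.+ -1ℤ ℤ.* v) (cong proj₁ (rowD-negative n)) (steps-alternate s (suc n)) ⟩
    + a ℤ.* (sign n ℤ.* + D d (suc n)) ℤ.+ -1ℤ ℤ.* (ℤ.- sign n ℤ.* + valFrom d (suc (suc n)) s)
      ≡⟨ lemma (+ a) (sign n) (+ D d (suc n)) (+ valFrom d (suc (suc n)) s) ⟩
    sign n ℤ.* (+ a ℤ.* + D d (suc n) ℤ.+ + valFrom d (suc (suc n)) s)
      ≡⟨ cong (sign n ℤ.*_) (sym (pos-*+ a _ _)) ⟩
    sign n ℤ.* + valFrom d (suc n) (a ∷ s) ∎
    where
    open ≡-Reasoning
    lemma : ∀ a s D v → a ℤ.* (s ℤ.* D) ℤ.+ -1ℤ ℤ.* (ℤ.- s ℤ.* v) ≡ s ℤ.* (a ℤ.* D ℤ.+ v)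
    lemma = solve-∀

  Conjugate : ℕ → List ℕ → List ℕ → Set
  Conjugate i y x = Σ ℕ λ k → steps i ⟦ reverse (map +_ y) ⟧ ≡ sign k ⊙ ⟦ alternate x ⟧

  ⟦alternate-0∷⟧ : ∀ s → step ⟦ alternate s ⟧ ≡ sign 1 ⊙ ⟦ alternate (0 ∷ s) ⟧
  ⟦alternate-0∷⟧ s = sym (begin
    -1ℤ ⊙ push 0ℤ ⟦ map ℤ.-_ (alternate s) ⟧      ≡⟨ cong (-1ℤ ⊙_) (push-0ℤ ⟦ map ℤ.-_ (alternate s) ⟧) ⟩
    -1ℤ ⊙ step ⟦ map ℤ.-_ (alternate s) ⟧         ≡⟨ cong (λ p → -1ℤ ⊙ step p) (⟦⟧-neg (alternate s)) ⟩
    -1ℤ ⊙ step (-1ℤ ⊙ ⟦ alternate s ⟧)            ≡⟨ cong (-1ℤ ⊙_) (step-⊙ -1ℤ ⟦ alternate s ⟧) ⟩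
    -1ℤ ⊙ -1ℤ ⊙ step ⟦ alternate s ⟧              ≡⟨ ⊙-assoc -1ℤ -1ℤ (step ⟦ alternate s ⟧) ⟩
    1ℤ ⊙ step ⟦ alternate s ⟧                     ≡⟨ ⊙-identityˡ (step ⟦ alternate s ⟧) ⟩
    step ⟦ alternate s ⟧                          ∎)
    where open ≡-Reasoning

  rowOf : List ℕ → ℕ → ℕ
  rowOf w n = val d (replicate (n ∸ 1) 0 ++ w)

  valFrom-replicate : ∀ k j x → valFrom d j (replicate k 0 ++ x) ≡ valFrom d (j + k) x
  valFrom-replicate zero    j x = cong (λ i → valFrom d i x) (sym (ℕ.+-identityʳ j))
  valFrom-replicate (suc k) j x = trans (valFrom-replicate k (suc j) x) (cong (λ i → valFrom d i x) (sym (ℕ.+-suc j k)))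

  row-conjugate : ∀ {i y x} → Conjugate i y x → 1 ≤ length y → ∀ n → 1 ≤ n →
    Row d (rowOf x) (+ n) ≡ + ∣ Row d (rowOf y) (+ 1 ℤ.- + length y ℤ.- + (i + n)) ∣
  row-conjugate {i} {y@(_ ∷ w)} {x} (k , conj) _ (suc n) _ = sym (begin
    + ∣ Row d (rowOf y) (+ 1 ℤ.- + length y ℤ.- + (i + suc n)) ∣
      ≡⟨ cong (λ t → + ∣ Row d (rowOf y) t ∣) (index (+ length w) (+ i) (+ n)) ⟩
    + ∣ proj₁ (back d (suc (suc (length w + (i + n)))) (+ val d y) (+ val d (0 ∷ y))) ∣
      ≡⟨ cong (λ p → + ∣ proj₁ p ∣) (back≡steps (suc (suc (length w + (i + n)))) (+ val d y) (+ val d (0 ∷ y))) ⟩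
    + ∣ proj₁ (steps (suc (suc (length w + (i + n)))) (valState 0 y)) ∣
      ≡⟨ cong (λ j → + ∣ proj₁ (steps j (valState 0 y)) ∣) (count (length w) i n) ⟩
    + ∣ proj₁ (steps (suc n + (i + length y)) (valState 0 y)) ∣
      ≡⟨ cong (λ p → + ∣ proj₁ p ∣) (trans (steps-+ (suc n) _ _) (cong (steps (suc n)) (steps-+ i (length y) _))) ⟩
    + ∣ proj₁ (steps (suc n) (steps i (steps (length y) (valState 0 y)))) ∣
      ≡⟨ cong (λ p → + ∣ proj₁ (steps (suc n) (steps i p)) ∣) (steps-valState-reverse y) ⟩
    + ∣ proj₁ (steps (suc n) (steps i ⟦ reverse (map +_ y) ⟧)) ∣
      ≡⟨ cong (λ p → + ∣ proj₁ (steps (suc n) p) ∣) conj ⟩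
    + ∣ proj₁ (steps (suc n) (sign k ⊙ ⟦ alternate x ⟧)) ∣
      ≡⟨ cong (λ p → + ∣ proj₁ p ∣) (steps-⊙ (suc n) (sign k) _) ⟩
    + ∣ sign k ℤ.* proj₁ (steps (suc n) ⟦ alternate x ⟧) ∣
      ≡⟨ cong (λ v → + ∣ sign k ℤ.* v ∣) (steps-alternate x n) ⟩
    + ∣ sign k ℤ.* (sign n ℤ.* + valFrom d (suc n) x) ∣
      ≡⟨ cong +_ (trans (∣sign*∣ k _) (∣sign*∣ n _)) ⟩
    + valFrom d (suc n) x
      ≡⟨ cong +_ (sym (valFrom-replicate n 1 x)) ⟩
    + rowOf x (suc n) ∎)
    where
    open ≡-Reasoning
    index : ∀ L i n → (+ 1 ℤ.- (1ℤ ℤ.+ L)) ℤ.- (i ℤ.+ (1ℤ ℤ.+ n)) ≡ ℤ.- (1ℤ ℤ.+ (L ℤ.+ (i ℤ.+ n)))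
    index = solve-∀
    count : ∀ L i n → suc (suc (L + (i + n))) ≡ suc n + (i + suc L)
    count = ℕ-solve-∀

  -- Rewriting an alternating string as a word

  needsCarry : List ℕ → Bool
  needsCarry (zero ∷ zero ∷ xs) = needsCarry xs
  needsCarry (zero ∷ suc _ ∷ _) = true
  needsCarry _                  = false

  -- A pair (p , q) borrows exactly when it would need a carry if p were 0.
  borrows : ℕ → List ℕ → Bool
  borrows q xs = needsCarry (0 ∷ q ∷ xs)

  -- Rewrites the alternating string carryIn c (alternate xs) into ordinary
  -- digits, two at a time, pushing them onto acc: a pair (p , - q) becomes
  -- (p - 1 , d - q) with a carry of 1 into the next pair (⟦⟧-borrow), and a
  -- last digit d is written 0 d. The list is matched before the carry so that
  -- convert c (p ∷ …) acc computes for a variable c.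
  convert : ℕ → List ℕ → List ℕ → List ℕ
  convert c       (p ∷ q ∷ xs) acc with T? (borrows q xs)
  ... | yes _ = convert 1 xs (d ∸ q ∷ p + c ∸ 1 ∷ acc)
  ... | no  _ = convert 0 xs (0 ∷ p + c ∷ acc)
  convert c       (p ∷ [])     acc with p + c ℕ.≟ d
  ... | yes _ = 0 ∷ d ∷ acc
  ... | no  _ = p + c ∷ acc
  convert zero    []           acc = acc
  convert (suc c) []           acc = suc c ∷ acc

  ⟦carryIn-alternate⟧ : ∀ c p q xs →
    ⟦ carryIn c (alternate (p ∷ q ∷ xs)) ⟧ ≡ ⟦ + p ℤ.+ c ∷ ℤ.- + q ∷ alternate xs ⟧
  ⟦carryIn-alternate⟧ c p q xs = cong (push _ ∘ push _ ∘ ⟦_⟧) (map-neg-involutive (alternate xs))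

  ⟦borrow-pair⟧ : ∀ c p q xs → 1 ≤ p + c → q ≤ d →
    ⟦ + (p + c ∸ 1) ∷ + (d ∸ q) ∷ carryIn 1ℤ (alternate xs) ⟧ ≡ ⟦ carryIn (+ c) (alternate (p ∷ q ∷ xs)) ⟧
  ⟦borrow-pair⟧ c p q xs 1≤p+c q≤d = begin
    ⟦ + (p + c ∸ 1) ∷ + (d ∸ q) ∷ carryIn 1ℤ (alternate xs) ⟧
      ≡⟨ cong₂ (λ a b → ⟦ a ∷ b ∷ carryIn 1ℤ (alternate xs) ⟧) p+c-1 d-q ⟩
    ⟦ + p ℤ.+ + c ℤ.- 1ℤ ∷ ℤ.- + q ℤ.+ + d ∷ carryIn 1ℤ (alternate xs) ⟧
      ≡⟨ sym (⟦⟧-borrow (+ p ℤ.+ + c) (ℤ.- + q) (alternate xs)) ⟩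
    ⟦ + p ℤ.+ + c ∷ ℤ.- + q ∷ alternate xs ⟧
      ≡⟨ sym (⟦carryIn-alternate⟧ (+ c) p q xs) ⟩
    ⟦ carryIn (+ c) (alternate (p ∷ q ∷ xs)) ⟧ ∎
    where
    open ≡-Reasoning
    p+c-1 : + (p + c ∸ 1) ≡ + p ℤ.+ + c ℤ.- 1ℤ
    p+c-1 = trans (pos-∸ 1≤p+c) (cong (ℤ._- 1ℤ) (ℤ.pos-+ p c))
    d-q : + (d ∸ q) ≡ ℤ.- + q ℤ.+ + d
    d-q = trans (pos-∸ q≤d) (ℤ.+-comm (+ d) (ℤ.- + q))

  ⟦keep-pair⟧ : ∀ c p xs →
    ⟦ + (p + c) ∷ 0ℤ ∷ carryIn 0ℤ (alternate xs) ⟧ ≡ ⟦ carryIn (+ c) (alternate (p ∷ 0 ∷ xs)) ⟧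
  ⟦keep-pair⟧ c p xs = begin
    ⟦ + (p + c) ∷ 0ℤ ∷ carryIn 0ℤ (alternate xs) ⟧
      ≡⟨ cong₂ (λ a t → push a (push 0ℤ t)) (ℤ.pos-+ p c) (⟦carryIn-0ℤ⟧ (alternate xs)) ⟩
    ⟦ + p ℤ.+ + c ∷ 0ℤ ∷ alternate xs ⟧
      ≡⟨ sym (⟦carryIn-alternate⟧ (+ c) p 0 xs) ⟩
    ⟦ carryIn (+ c) (alternate (p ∷ 0 ∷ xs)) ⟧ ∎
    where open ≡-Reasoning

  borrow⇒1≤p+c : ∀ c p q xs → (T (needsCarry (p ∷ q ∷ xs)) → c ≡ 1) → T (borrows q xs) → 1 ≤ p + c
  borrow⇒1≤p+c c (suc p) q xs _         _ = s≤s z≤n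
  borrow⇒1≤p+c c zero    q xs carry⇒c≡1 b rewrite carry⇒c≡1 b = s≤s z≤n

  no-borrow⇒q≡0 : ∀ q xs → ¬ T (borrows q xs) → q ≡ 0
  no-borrow⇒q≡0 zero    xs _  = refl
  no-borrow⇒q≡0 (suc q) xs ¬b = ⊥-elim (¬b tt)

  convert-value : ∀ c xs acc → (T (needsCarry xs) → c ≡ 1) → All (_≤ d) xs →
    ⟦ reverse (map +_ (convert c xs acc)) ⟧ ≡ ⟦ map +_ acc ʳ++ carryIn (+ c) (alternate xs) ⟧
  convert-value zero    []           acc _ _ = ⟦⟧-ʳ++-cong (map +_ acc) (sym (⟦carryIn-0ℤ⟧ []))
  convert-value (suc c) []           acc _ _ = refl
  convert-value c       (p ∷ [])     acc _ _ with p + c ℕ.≟ d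
  ... | yes p+c≡d = ⟦⟧-ʳ++-cong (map +_ acc)
                      (cong₂ push (cong +_ (sym p+c≡d)) (trans (push-0ℤ 0ₛ) (steps-0ₛ 1)))
  ... | no  _     = refl
  convert-value c (p ∷ q ∷ xs) acc carry⇒c≡1 (_ ∷ q≤d ∷ xs≤d) with T? (borrows q xs)
  ... | yes b = trans (convert-value 1 xs _ (λ _ → refl) xs≤d)
                      (⟦⟧-ʳ++-cong (map +_ acc) (⟦borrow-pair⟧ c p q xs (borrow⇒1≤p+c c p q xs carry⇒c≡1 b) q≤d))
  ... | no ¬b with refl ← no-borrow⇒q≡0 q xs ¬b =
                trans (convert-value 0 xs _ (λ carry → ⊥-elim (¬b carry)) xs≤d)
                      (⟦⟧-ʳ++-cong (map +_ acc) (⟦keep-pair⟧ c p xs))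

  -- Trimmedness of the rewritten word

  NonzeroEnd : ℕ → List ℕ → Set
  NonzeroEnd c []       = c ≡ 1
  NonzeroEnd c (x ∷ xs) = LastNonzero (x ∷ xs)

  -- acc-head: the digit emitted next, in front of a leading d of acc, will be 0.
  record Invariant (c : ℕ) (xs acc : List ℕ) : Set where
    field
      xs≤d         : All (_≤ d) xs
      xs-adjacent  : AdjOK d xs
      xs-end       : NonzeroEnd c xs
      carry-needed : T (needsCarry xs) → c ≡ 1
      head+carry≤d : head₀ xs + c ≤ d
      acc≤d        : All (_≤ d) acc
      acc-adjacent : AdjOK d acc
      acc-head     : head₀ acc ≡ d → T (needsCarry xs)

  needsCarry⇒head≡0 : ∀ p xs → T (needsCarry (p ∷ xs)) → p ≡ 0
  needsCarry⇒head≡0 zero xs _ = refl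

  needsCarry-∷0 : ∀ p xs → T (needsCarry (p ∷ 0 ∷ xs)) → T (needsCarry xs)
  needsCarry-∷0 zero xs carry = carry

  ¬needsCarry-[_] : ∀ p → ¬ T (needsCarry (p ∷ []))
  ¬needsCarry-[ zero  ] ()
  ¬needsCarry-[ suc p ] ()

  adjacent-∷ : ∀ {a acc} → (head₀ acc ≡ d → a ≡ 0) → AdjOK d acc → AdjOK d (a ∷ acc)
  adjacent-∷ {acc = []}    _ _   = tt
  adjacent-∷ {acc = _ ∷ _} h adj = h , adj

  adjacent-tail : ∀ a xs → AdjOK d (a ∷ xs) → AdjOK d xs
  adjacent-tail a []      _         = tt
  adjacent-tail a (_ ∷ _) (_ , adj) = adj

  ¬zero-prefix : ∀ {a w} → a ≢ 0 → ¬ (Σ (List ℕ) λ v → (a ∷ w ≡ 0 ∷ v) × IsOstrowski d v)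
  ¬zero-prefix a≢0 (_ , eq , _) = a≢0 (List.∷-injectiveˡ eq)

  module _ (2≤d : 2 ≤ d) where

    1≤d : 1 ≤ d
    1≤d = ℕ.≤-trans (s≤s z≤n) 2≤d

    d≢0 : d ≢ 0
    d≢0 d≡0 = ℕ.<-irrefl (sym d≡0) 1≤d

    borrow-next-head : ∀ q xs → All (_≤ d) xs → AdjOK d (q ∷ xs) → T (borrows q xs) → head₀ xs + 1 ≤ d
    borrow-next-head q []      _         _             _ = 1≤d
    borrow-next-head q (r ∷ s) (r≤d ∷ _) (r≡d⇒q≡0 , _) b =
      subst (_≤ d) (ℕ.+-comm 1 r) (ℕ.≤∧≢⇒< r≤d r≢d)
      where
      r≢d : r ≢ d
      r≢d r≡d with refl ← r≡d⇒q≡0 r≡d = d≢0 (trans (sym r≡d) (needsCarry⇒head≡0 r s b))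

    Invariant-borrow : ∀ {c p q xs acc} → Invariant c (p ∷ q ∷ xs) acc → T (borrows q xs) →
                       Invariant 1 xs (d ∸ q ∷ p + c ∸ 1 ∷ acc)
    Invariant-borrow {c} {p} {q} {xs} {acc} I b = record
      { xs≤d         = xs≤d′
      ; xs-adjacent  = adjacent-tail q xs (proj₂ xs-adjacent)
      ; xs-end       = end xs xs-end
      ; carry-needed = λ _ → refl
      ; head+carry≤d = borrow-next-head q xs xs≤d′ (proj₂ xs-adjacent) b
      ; acc≤d        = ℕ.m∸n≤m d q ∷ ℕ.≤-trans (ℕ.m∸n≤m (p + c) 1) head+carry≤d ∷ acc≤d
      ; acc-adjacent = (λ e → ⊥-elim (ℕ.<-irrefl e p+c-1<d)) , adjacent-∷ p+c-1≡0 acc-adjacent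
      ; acc-head     = λ d-q≡d → subst (λ q → T (borrows q xs)) (m∸n≡m⇒n≡0 q 1≤d d-q≡d) b
      }
      where
      open Invariant I
      xs≤d′ = All.tail (All.tail xs≤d)
      p+c-1<d : p + c ∸ 1 < d
      p+c-1<d = m∸1<n (borrow⇒1≤p+c c p q xs carry-needed b) head+carry≤d
      p+c-1≡0 : head₀ acc ≡ d → p + c ∸ 1 ≡ 0
      p+c-1≡0 e with refl ← needsCarry⇒head≡0 p (q ∷ xs) (acc-head e) | refl ← carry-needed (acc-head e) = refl
      end : ∀ xs → NonzeroEnd c (p ∷ q ∷ xs) → NonzeroEnd 1 xs
      end []      _  = refl
      end (_ ∷ _) ln = ln

    Invariant-keep : ∀ {c p xs acc} → Invariant c (p ∷ 0 ∷ xs) acc → ¬ T (needsCarry xs) →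
                     Invariant 0 xs (0 ∷ p + c ∷ acc)
    Invariant-keep {c} {p} {xs} {acc} I ¬carry = record
      { xs≤d         = xs≤d′
      ; xs-adjacent  = adjacent-tail 0 xs (proj₂ xs-adjacent)
      ; xs-end       = end xs xs-end
      ; carry-needed = λ carry → ⊥-elim (¬carry carry)
      ; head+carry≤d = next-head xs xs≤d′
      ; acc≤d        = z≤n ∷ head+carry≤d ∷ acc≤d
      ; acc-adjacent = (λ _ → refl) , adjacent-∷ (λ e → ⊥-elim (¬carry (needsCarry-∷0 p xs (acc-head e)))) acc-adjacent
      ; acc-head     = λ 0≡d → ⊥-elim (d≢0 (sym 0≡d))
      }
      where
      open Invariant I
      xs≤d′ = All.tail (All.tail xs≤d)
      end : ∀ xs → NonzeroEnd c (p ∷ 0 ∷ xs) → NonzeroEnd 0 xs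
      end []      ln = ⊥-elim (ln refl)
      end (_ ∷ _) ln = ln
      next-head : ∀ xs → All (_≤ d) xs → head₀ xs + 0 ≤ d
      next-head []      _         = z≤n
      next-head (r ∷ _) (r≤d ∷ _) = subst (_≤ d) (sym (ℕ.+-identityʳ r)) r≤d

    trimmed-∷ : ∀ {a acc} → a < d → All (_≤ d) acc → AdjOK d acc → head₀ acc ≢ d →
                LastNonzero (a ∷ acc) → a ≢ 0 → Trimmed d (a ∷ acc)
    trimmed-∷ a<d acc≤d adj head≢d ln a≢0 =
      (a<d , ℕ.<⇒≤ a<d ∷ acc≤d , adjacent-∷ (⊥-elim ∘ head≢d) adj) , ln , ¬zero-prefix a≢0

    trimmed-0∷d∷ : ∀ {acc} → All (_≤ d) acc → AdjOK d acc → head₀ acc ≢ d → LastNonzero (d ∷ acc) →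
                   Trimmed d (0 ∷ d ∷ acc)
    trimmed-0∷d∷ acc≤d adj head≢d ln =
      (1≤d , z≤n ∷ ℕ.≤-refl ∷ acc≤d , (λ _ → refl) , adjacent-∷ (⊥-elim ∘ head≢d) adj) ,
      ln , λ { (_ , refl , (d<d , _)) → ℕ.<-irrefl refl d<d }

    convert-trimmed : ∀ c xs acc → Invariant c xs acc → LastNonzero acc → Trimmed d (convert c xs acc)
    convert-trimmed c (p ∷ q ∷ xs) acc I ln with T? (borrows q xs)
    ... | yes b = convert-trimmed 1 xs _ (Invariant-borrow I b) (lastNonzero-∷ (p + c ∸ 1) acc ln)
    ... | no ¬b with refl ← no-borrow⇒q≡0 q xs ¬b =
      convert-trimmed 0 xs _ (Invariant-keep I ¬b) (lastNonzero-∷ (p + c) acc ln)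
    convert-trimmed c (p ∷ []) acc I ln with p + c ℕ.≟ d
    ... | yes _    = trimmed-0∷d∷ acc≤d acc-adjacent (¬needsCarry-[ p ] ∘ acc-head) (lastNonzero-∷ d acc ln)
      where open Invariant I
    ... | no p+c≢d = trimmed-∷ (ℕ.≤∧≢⇒< head+carry≤d p+c≢d) acc≤d acc-adjacent (¬needsCarry-[ p ] ∘ acc-head)
                       (lastNonzero-∷ (p + c) acc ln) (xs-end ∘ ℕ.m+n≡0⇒m≡0 p)
      where open Invariant I
    convert-trimmed (suc zero) [] acc I ln =
      trimmed-∷ 2≤d acc≤d acc-adjacent acc-head (lastNonzero-∷ 1 acc ln) (λ ())
      where open Invariant I
    convert-trimmed zero          [] _ I _ with () ← Invariant.xs-end I
    convert-trimmed (suc (suc _)) [] _ I _ with () ← Invariant.xs-end I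

    Invariant-initial : ∀ {p s} → 1 ≤ p → All (_≤ d) (p ∷ s) → AdjOK d (p ∷ s) → LastNonzero (p ∷ s) →
                        Invariant 0 (p ∷ s) []
    Invariant-initial {suc p} _ x≤d adj ln = record
      { xs≤d         = x≤d
      ; xs-adjacent  = adj
      ; xs-end       = ln
      ; carry-needed = λ ()
      ; head+carry≤d = subst (_≤ d) (sym (ℕ.+-identityʳ (suc p))) (All.head x≤d)
      ; acc≤d        = []
      ; acc-adjacent = tt
      ; acc-head     = λ 0≡d → ⊥-elim (d≢0 (sym 0≡d))
      }

    Invariant-drop-trailing-0 : ∀ {c xs a} → Invariant c xs (a ∷ 0 ∷ []) → Invariant c xs (a ∷ [])
    Invariant-drop-trailing-0 I = record
      { xs≤d = xs≤d ; xs-adjacent = xs-adjacent ; xs-end = xs-end ; carry-needed = carry-needed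
      ; head+carry≤d = head+carry≤d ; acc≤d = All.head acc≤d ∷ [] ; acc-adjacent = tt ; acc-head = acc-head }
      where open Invariant I

    convert-value₀ : ∀ x → Invariant 0 x [] → ⟦ reverse (map +_ (convert 0 x [])) ⟧ ≡ ⟦ alternate x ⟧
    convert-value₀ x I = trans (convert-value 0 x [] carry-needed xs≤d) (⟦carryIn-0ℤ⟧ (alternate x))
      where open Invariant I

    -- When x starts with 1 and its first pair borrows, convert emits a final
    -- 0, which is dropped at the price of one more backward step.
    conjugate-nonzero-head : ∀ {p s} → 1 ≤ p → Invariant 0 (p ∷ s) [] →
      Σ (List ℕ) λ y → Trimmed d y × Σ ℕ λ i → i ≤ 1 × (2 ≤ p → i ≡ 0) ×
        steps i ⟦ reverse (map +_ y) ⟧ ≡ ⟦ alternate (p ∷ s) ⟧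
    conjugate-nonzero-head {p} {[]} 1≤p I with p + 0 ℕ.≟ d | convert-value₀ (p ∷ []) I
    ... | yes _     | value = _ , trimmed-0∷d∷ [] tt (d≢0 ∘ sym) d≢0 , 0 , z≤n , (λ _ → refl) , value
    ... | no p+0≢d | value =
      _ , trimmed-∷ (ℕ.≤∧≢⇒< (Invariant.head+carry≤d I) p+0≢d) [] tt (d≢0 ∘ sym) (m+0≢0 1≤p) (m+0≢0 1≤p) ,
      0 , z≤n , (λ _ → refl) , value
    conjugate-nonzero-head {p} {q ∷ s} 1≤p I with T? (borrows q s) | convert-value₀ (p ∷ q ∷ s) I
    ... | no ¬b | value with refl ← no-borrow⇒q≡0 q s ¬b =
      _ , convert-trimmed 0 s _ (Invariant-keep I ¬b) (m+0≢0 1≤p) , 0 , z≤n , (λ _ → refl) , value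
    conjugate-nonzero-head {suc (suc p)} {q ∷ s} _ I | yes b | value =
      _ , convert-trimmed 1 s _ (Invariant-borrow I b) (λ ()) , 0 , z≤n , (λ _ → refl) , value
    conjugate-nonzero-head {suc zero} {q ∷ s} _ I | yes b | _ =
      _ , convert-trimmed 1 s _ (Invariant-drop-trailing-0 (Invariant-borrow I b)) d∸q≢0 ,
      1 , ℕ.≤-refl , (λ { (s≤s ()) }) , value
      where
      open Invariant I
      q≤d = All.head (All.tail xs≤d)
      d∸q≢0 : d ∸ q ≢ 0
      d∸q≢0 e = ℕ.<⇒≱ (ℕ.≤∧≢⇒< q≤d ((λ ()) ∘ proj₁ xs-adjacent)) (ℕ.m∸n≡0⇒m≤n e)
      value : step ⟦ reverse (map +_ (convert 1 s (d ∸ q ∷ []))) ⟧ ≡ ⟦ alternate (1 ∷ q ∷ s) ⟧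
      value = begin
        step ⟦ reverse (map +_ (convert 1 s (d ∸ q ∷ []))) ⟧
          ≡⟨ cong step (convert-value 1 s _ (λ _ → refl) (All.tail (All.tail xs≤d))) ⟩
        step ⟦ + (d ∸ q) ∷ carryIn 1ℤ (alternate s) ⟧
          ≡⟨ sym (push-0ℤ ⟦ + (d ∸ q) ∷ carryIn 1ℤ (alternate s) ⟧) ⟩
        ⟦ 0ℤ ∷ + (d ∸ q) ∷ carryIn 1ℤ (alternate s) ⟧
          ≡⟨ ⟦borrow-pair⟧ 0 1 q s (s≤s z≤n) q≤d ⟩
        ⟦ carryIn 0ℤ (alternate (1 ∷ q ∷ s)) ⟧
          ≡⟨ ⟦carryIn-0ℤ⟧ (alternate (1 ∷ q ∷ s)) ⟩
        ⟦ alternate (1 ∷ q ∷ s) ⟧ ∎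
        where open ≡-Reasoning

    2≤second-digit : ∀ {a s} → Trimmed d (0 ∷ a ∷ s) → 2 ≤ a
    2≤second-digit {a} {s} ((_ , _ ∷ a≤d ∷ s≤d , _ , adj) , _ , ¬0∷) =
      subst (2 ≤_) (ℕ.≤-antisym (ℕ.≮⇒≥ λ a<d → ¬0∷ (a ∷ s , refl , a<d , a≤d ∷ s≤d , adj)) a≤d) 2≤d

    conjugate : ∀ x → Trimmed d x → Σ (List ℕ) λ y → Trimmed d y × Σ ℕ λ i → i ≤ 1 × Conjugate i y x
    conjugate []            (_ , () , _)
    conjugate (zero ∷ [])   (_ , ln , _) = ⊥-elim (ln refl)
    conjugate (suc p ∷ s)   ((_ , x≤d , adj) , ln , _)
      with conjugate-nonzero-head (s≤s z≤n) (Invariant-initial (s≤s z≤n) x≤d adj ln)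
    ... | y , y-trimmed , i , i≤1 , _ , eq = y , y-trimmed , i , i≤1 , 0 , trans eq (sym (⊙-identityˡ _))
    conjugate (zero ∷ a ∷ s) t@((_ , _ ∷ x≤d , _ , adj) , ln , _)
      with conjugate-nonzero-head 1≤a (Invariant-initial 1≤a x≤d adj ln)
      where 1≤a = ℕ.≤-trans (s≤s z≤n) (2≤second-digit t)
    ... | y , y-trimmed , i , _ , i≡0 , eq with refl ← i≡0 (2≤second-digit t) =
      y , y-trimmed , 1 , ℕ.≤-refl , 1 , trans (cong step eq) (⟦alternate-0∷⟧ (a ∷ s))

corollary6 : (d : ℕ) → 2 ≤ d → (e : ℕ → List ℕ) → IsTrimmedEnumeration d e →
    (m : ℕ) → 1 ≤ m →
      Σ ℕ λ k → 1 ≤ k × Σ ℕ λ i → i ≤ 1 ×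
        ((n : ℕ) → 1 ≤ n → A d e m (+ n) ≡ + ∣ Abar d e k (+ (i + n)) ∣)
corollary6 d 2≤d e (trimmed , _ , enumerates) m 1≤m
  with conjugate d 2≤d (e m) (trimmed m 1≤m)
... | y , y-trimmed , i , i≤1 , conj with enumerates y y-trimmed
... | k , 1≤k , refl = k , 1≤k , i , i≤1 , row-conjugate d {i} {e k} conj (nonempty (e k) (proj₁ (proj₂ y-trimmed)))
  where
  nonempty : ∀ w → LastNonzero w → 1 ≤ length w
  nonempty (_ ∷ _) _ = s≤s z≤n
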